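{- Under the standing assumptions below, let $A\subseteq V_G$ be strongly compressed, let $B_1<B_2$ be blocks of $G$ (in the block order) that share the $i$-th bone for some $i\in\{1,\dots,d\}$, and suppose $\mathrm{Bone}_G(B_2,i)\subseteq A$. Then $B_1\subseteq A$.
   Context: All graphs are finite and simple. For $G=(V,E)$, $I_G(A,B)$ is the set of edges with one end in $A$ and the other in $B$, $I_G(A)=I_G(A,A)$, $I_G(m)=\max_{|S|=m}|I_G(S)|$. A total order is a bijection $\mathcal O:V\to\{1,\dots,|V|\}$, $\mathcal O[k,l]=\mathcal O^{ -1}(\{k,\dots,l\})$; it is optimal if $|I_G(\mathcal O[1,k])|=I_G(k)$ for all $k$; $G$ is isoperimetric if it has one. $\delta_G(1)=0$, $\delta_G(m)=I_G(m)-I_G(m-1)$. Cartesian product $G_1\square\cdots\square G_d$: tuples adjacent iff they differ in exactly one coordinate, where they are adjacent. Lexicographic order on $\mathbb R^k$: $x<y$ iff for some $i$, $x_1=y_1,\dots,x_i=y_i$, $x_{i+1}<y_{i+1}$. For $\pi\in\mathfrak S_k$, $\mathcal D^{\pi,k}$ compares $(x_{\pi(1)},\dots,x_{\pi(k)})$ lexicographically; orders on $\mathbb R^k$ induce orders on products of ordered sets via rank tuples. Isoperimetric partition of isoperimetric $G$ with optimal $\mathcal O_G$: partition into consecutive intervals $\mathcal O_G[a_i,b_i]$ such that each part induces an isoperimetric subgraph with the restricted order optimal, and every $v\in\mathcal O_G[a_i,b_i]$ has exactly $\delta_G(a_i)$ neighbours in $\mathcal O_G[a_1,b_{i-1}]$.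 Starts of parts are their first vertices. Non-decreasing: each part's induced subgraph has non-decreasing $\delta$-sequence. Regular: first and last parts' induced subgraphs have equal $\delta$-sequences. Setup: $G_i$ ($1\le i\le d$) isoperimetric with fixed optimal orders $\mathcal O_{G_i}$ and isoperimetric partitions $\mathfrak P_{G_i}$; $G=G_1\square\cdots\square G_d$; $G_S=G_{i_1}\square\cdots\square G_{i_k}$ for $S=\{i_1<\dots<i_k\}$. Blocks of $G_S$: $Z_{i_1}\times\cdots\times Z_{i_k}$, $Z_{i_j}\in\mathfrak P_{G_{i_j}}$; start: tuple of starts. An order $\mathcal O$ on a product is consistent with an order $\mathcal O'$ on the subproduct over $S$ if $x<_{\mathcal O}y$ and $x_j=y_j$ for $j\notin S$ imply the same inequality of projections in $\mathcal O'$. Domination collection: each block $B$ of each $G_S$ has $\pi_B\in\mathfrak S_{|S|}$ such that the order $\mathcal D_B$ induced by $\mathcal D^{\pi_B,|S|}$ on $B$ (coordinates ranked by restrictions of $\mathcal O_{G_{i_j}}$) is optimal for the subgraph induced by $B$, and for $S_1\subset S_2$, $\mathcal D_{B_2}$ is consistent with $\mathcal D_{B_1}$ when $B_1$ consists of the factors of $B_2$ indexed by $S_1$. $\mathcal{BL}^k_{G_S}$: same block: compare by $\mathcal D_B$; different blocks: compare starts lexicographically; $\mathcal{BL}^d_G=\mathcal{BL}^d_{G_{\{1,\dots,d\}}}$. Regular domination collection: $\mathfrak P_{G_i}$ regular for $2\le i\le d-1$, and $\pi_{B_1}=\pi_{B_2}$ for $B_1$ (resp. $B_2$) the product of the first (resp.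 last) parts of $\mathfrak P_{G_2},\dots,\mathfrak P_{G_{d-1}}$. Standing assumptions: $d\ge3$; the $\mathfrak P_{G_i}$ form a regular domination collection; $\mathfrak P_{G_i}$ non-decreasing for $i\le d-1$; $\mathcal{BL}^2_{G_i\square G_j}$ optimal for all $i<j$. Compression: for nonempty proper $S$ with an order on $G_S$, and $x\in V_{G_{\overline S}}$, the section $G_S(x)$ is the set of vertices of $G$ with $\overline S$-coordinates equal to $x$, ordered via its isomorphism with $G_S$; compression replaces each $A\cap G_S(x)$ by the initial segment of $G_S(x)$ of the same size. $A$ is strongly compressed if it is unchanged by compression for every nonempty proper $S$ with respect to $\mathcal{BL}^{|S|}_{G_S}$. Geometry: blocks of $G$ are ordered by $\mathcal{BL}^d_G$ of their starts. For a block $B=Z_1\times\cdots\times Z_d$ with start $(t_1,\dots,t_d)$, $\mathrm{Bone}_G(B,i)=\{t_1\}\times\cdots\times\{t_{i-1}\}\times Z_i\times\{t_{i+1}\}\times\cdots\times\{t_d\}$. Distinct blocks $Z_1\times\cdots\times Z_d$ and $Y_1\times\cdots\times Y_d$ share the $i$-th bone if $Y_i=Z_i$. -}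

module Defs where

open import Data.Bool using (Bool; true; false; if_then_else_; _∧_; _∨_; not; T)
open import Data.Nat using (ℕ; zero; suc; _+_; _∸_; _≤_; _<_; _⊔_; _<ᵇ_; _≡ᵇ_)
import Data.Nat as ℕ
open import Data.Fin using (Fin; toℕ)
import Data.Fin as Fin
open import Data.Nat.ListAction using (sum)
open import Data.List using (List; []; _∷_; length; take; drop; map; concatMap; filterᵇ; upTo; allFin; foldr)
open import Data.List.Membership.Propositional using (_∈_)
open import Data.List.Relation.Binary.Permutation.Propositional using (_↭_)
open import Data.List.Relation.Unary.AllPairs using (AllPairs)
open import Data.Vec using (Vec; lookup; tabulate; replicate; _[_]≔_)
open import Data.Vec.Properties using (≡-dec)
open import Data.Product using (Σ; ∃; _×_; _,_)
open import Relation.Nullary using (¬_; does)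
open import Relation.Binary.PropositionalEquality using (_≡_; _≢_)

-- Generic finite combinatorics on lists
-- A finite vertex set is a duplicate-free list; a set of vertices is a
-- sublist of it; adjacency is Bool-valued.

countB : ∀ {A : Set} → (A → Bool) → List A → ℕ
countB p [] = 0
countB p (x ∷ xs) = if p x then suc (countB p xs) else countB p xs

-- |I_G(W)| : number of edges with both ends in the (duplicate-free) list W
edges : ∀ {A : Set} → (A → A → Bool) → List A → ℕ
edges adj [] = 0
edges adj (w ∷ ws) = countB (adj w) ws + edges adj ws

sublists : ∀ {A : Set} → List A → List (List A)
sublists [] = [] ∷ []
sublists (x ∷ xs) = let r = sublists xs in r Data.List.++ map (x ∷_) r

allB : ∀ {A : Set} → (A → Bool) → List A → Bool
allB p [] = true
allB p (x ∷ xs) = p x ∧ allB p xs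

maxL : List ℕ → ℕ
maxL = foldr _⊔_ 0

Imax : ∀ {A : Set} → (A → A → Bool) → List A → ℕ → ℕ
Imax adj W m = maxL (map (edges adj) (filterᵇ (λ S → length S ≡ᵇ m) (sublists W)))

-- δ(1) = 0, δ(m) = I(m) - I(m-1)  (m ≥ 2); δ(0) is unused
delta : (ℕ → ℕ) → ℕ → ℕ
delta I 0 = 0
delta I 1 = 0
delta I (suc (suc m)) = I (suc (suc m)) ∸ I (suc m)

-- an order on the vertex list W (given as a list ord, O[1,k] = take k ord)
-- is optimal for the graph induced on W
OptimalOrd : ∀ {A : Set} → (A → A → Bool) → List A → List A → Set
OptimalOrd adj W ord = (ord ↭ W) × (∀ m → m ≤ length W → edges adj (take m ord) ≡ Imax adj W m)

OptimalBy : ∀ {A : Set} → (A → A → Bool) → List A → (A → A → Bool) → Set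
OptimalBy {A} adj W lt = Σ (List A) λ ord → OptimalOrd adj W ord × AllPairs (λ a b → T (lt a b)) ord

lexLtB : List ℕ → List ℕ → Bool
lexLtB [] [] = false
lexLtB (a ∷ as) (b ∷ bs) = (a <ᵇ b) ∨ ((a ≡ᵇ b) ∧ lexLtB as bs)
lexLtB _ _ = false

nth : List ℕ → ℕ → ℕ
nth [] _ = 0
nth (x ∷ xs) zero = x
nth (x ∷ xs) (suc k) = nth xs k

-- position (0-based) of v in the list ord
rankL : List ℕ → ℕ → ℕ
rankL [] v = 0
rankL (w ∷ ws) v = if w ≡ᵇ v then 0 else suc (rankL ws v)

partIdx : List ℕ → ℕ → ℕ
partIdx [] r = 0
partIdx (l ∷ ls) r = if r <ᵇ l then 0 else suc (partIdx ls (r ∸ l))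

prodL : ∀ {k} → Vec (List ℕ) k → List (Vec ℕ k)
prodL Vec.[] = Vec.[] ∷ []
  where import Data.Vec as Vec
prodL (r Vec.∷ rs) = concatMap (λ a → map (a Vec.∷_) (prodL rs)) r
  where import Data.Vec as Vec

-- Factor j has vertex set {0,…,n j - 1} (labels in ℕ),
-- adjacency adj j, a fixed order O_{G_j} given as the list ord j
-- (O[1,k] = take k (ord j)), and a partition of the order into consecutive
-- intervals with lengths lens j.

record Factors (d : ℕ) : Set where
  field
    n      : Fin d → ℕ
    adj    : Fin d → ℕ → ℕ → Bool
    adj-sym    : ∀ j u v → u < n j → v < n j → adj j u v ≡ adj j v u
    adj-irrefl : ∀ j u → u < n j → adj j u u ≡ false
    ord    : Fin d → List ℕ
    lens   : Fin d → List ℕ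

  V : Fin d → List ℕ
  V j = upTo (n j)

  numParts : Fin d → ℕ
  numParts j = length (lens j)

  -- 0-based position of the start of part k  (so a_k = startPos j k + 1)
  startPos : Fin d → ℕ → ℕ
  startPos j k = sum (take k (lens j))

  part : Fin d → ℕ → List ℕ
  part j k = take (nth (lens j) k) (drop (startPos j k) (ord j))

  rank : Fin d → ℕ → ℕ
  rank j v = rankL (ord j) v

  IG : Fin d → ℕ → ℕ
  IG j = Imax (adj j) (V j)

  deltaPart : Fin d → ℕ → ℕ → ℕ
  deltaPart j k = delta (Imax (adj j) (part j k))

  OrderOptimal : Fin d → Set
  OrderOptimal j = OptimalOrd (adj j) (V j) (ord j)

  IsoPartition : Fin d → Set
  IsoPartition j =
      (∀ l → l ∈ lens j → 1 ≤ l)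
    × (sum (lens j) ≡ n j)
    × (∀ k → k < numParts j →
         (∀ m → m ≤ length (part j k) →
            edges (adj j) (take m (part j k)) ≡ Imax (adj j) (part j k) m)
       × (∀ v → v ∈ part j k →
            countB (adj j v) (take (startPos j k) (ord j)) ≡ delta (IG j) (suc (startPos j k))))

  NonDecreasing : Fin d → Set
  NonDecreasing j = ∀ k → k < numParts j → ∀ m m' → 1 ≤ m → m ≤ m' → m' ≤ length (part j k) →
                      deltaPart j k m ≤ deltaPart j k m'

  RegularPartition : Fin d → Set
  RegularPartition j =
      (length (part j 0) ≡ length (part j (numParts j ∸ 1)))
    × (∀ m → 1 ≤ m → m ≤ length (part j 0) → deltaPart j 0 m ≡ deltaPart j (numParts j ∸ 1) m)

-- Subsets S ⊆ {1..d} are Vec Bool d.  The vertices of G_S are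
-- represented as d-tuples whose coordinates outside S are 0 (a canonical
-- copy of G_S); blocks of G_S are given by tuples c of part indices (0
-- outside S).  A domination collection assigns to each block of each G_S a
-- list π of coordinate indices, a permutation of the elements of S
-- (π(1),…,π(k) written as coordinates of G).

module Product {d : ℕ} (F : Factors d) (π : Vec Bool d → Vec ℕ d → List (Fin d)) where
  open Factors F

  inS : Vec Bool d → Fin d → Bool
  inS S j = lookup S j

  elems : Vec Bool d → List (Fin d)
  elems S = filterᵇ (inS S) (allFin d)

  _⊆S_ : Vec Bool d → Vec Bool d → Set
  S₁ ⊆S S₂ = ∀ j → inS S₁ j ≡ true → inS S₂ j ≡ true

  fullS : Vec Bool d
  fullS = replicate d true

  NonemptyProper : Vec Bool d → Set
  NonemptyProper S = (∃ λ j → inS S j ≡ true) × (∃ λ j → inS S j ≡ false)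

  proj : Vec Bool d → Vec ℕ d → Vec ℕ d
  proj S x = tabulate (λ j → if inS S j then lookup x j else 0)

  vertsS : Vec Bool d → List (Vec ℕ d)
  vertsS S = prodL (tabulate (λ j → if inS S j then V j else 0 ∷ []))

  vertsG : List (Vec ℕ d)
  vertsG = vertsS fullS

  adjP : Vec ℕ d → Vec ℕ d → Bool
  adjP x y = (countB (λ j → not (lookup x j ≡ᵇ lookup y j)) (allFin d) ≡ᵇ 1)
           ∧ allB (λ j → (lookup x j ≡ᵇ lookup y j) ∨ adj j (lookup x j) (lookup y j)) (allFin d)

  ValidBlock : Vec Bool d → Vec ℕ d → Set
  ValidBlock S c = ∀ j → (inS S j ≡ true → lookup c j < numParts j) × (inS S j ≡ false → lookup c j ≡ 0)

  blockVerts : Vec Bool d → Vec ℕ d → List (Vec ℕ d)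
  blockVerts S c = prodL (tabulate (λ j → if inS S j then part j (lookup c j) else 0 ∷ []))

  Dlt : List (Fin d) → Vec ℕ d → Vec ℕ d → Bool
  Dlt p x y = lexLtB (map (λ j → rank j (lookup x j)) p) (map (λ j → rank j (lookup y j)) p)

  DominationCollection : Set
  DominationCollection =
      (∀ S c → ValidBlock S c → π S c ↭ elems S)
    × (∀ S c → ValidBlock S c → OptimalBy adjP (blockVerts S c) (Dlt (π S c)))
    × (∀ S₁ S₂ c → S₁ ⊆S S₂ → ValidBlock S₂ c → ∀ x y →
         x ∈ blockVerts S₂ c → y ∈ blockVerts S₂ c →
         Dlt (π S₂ c) x y ≡ true →
         (∀ j → inS S₁ j ≡ false → lookup x j ≡ lookup y j) →
         Dlt (π S₁ (proj S₁ c)) (proj S₁ x) (proj S₁ y) ≡ true)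

  -- middle coordinates 2..d-1 (0-based: 1..d-2)
  mid : Fin d → Bool
  mid j = (1 ℕ.≤ᵇ toℕ j) ∧ (toℕ j ℕ.≤ᵇ d ∸ 2)

  midS : Vec Bool d
  midS = tabulate mid

  RegularDominationCollection : Set
  RegularDominationCollection =
      DominationCollection
    × (∀ j → mid j ≡ true → RegularPartition j)
    × (π midS (replicate d 0) ≡ π midS (tabulate (λ j → if mid j then numParts j ∸ 1 else 0)))

  blockOf : Vec Bool d → Vec ℕ d → Vec ℕ d
  blockOf S x = tabulate (λ j → if inS S j then partIdx (lens j) (rank j (lookup x j)) else 0)

  startTup : Vec Bool d → Vec ℕ d → List ℕ
  startTup S x = map (λ j → startPos j (lookup (blockOf S x) j)) (elems S)

  BL : Vec Bool d → Vec ℕ d → Vec ℕ d → Bool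
  BL S x y = if does (≡-dec ℕ._≟_ (blockOf S x) (blockOf S y))
             then Dlt (π S (blockOf S x)) x y
             else lexLtB (startTup S x) (startTup S y)

  pairS : Fin d → Fin d → Vec Bool d
  pairS i j = tabulate (λ k → does (k Fin.≟ i) ∨ does (k Fin.≟ j))

  section : Vec Bool d → Vec ℕ d → List (Vec ℕ d)
  section S y = filterᵇ (λ z → allB (λ j → inS S j ∨ (lookup z j ≡ᵇ lookup y j)) (allFin d)) vertsG

  -- membership of y in the compression of A along S (w.r.t. BL^{|S|}_{G_S})
  compress : Vec Bool d → (Vec ℕ d → Bool) → Vec ℕ d → Bool
  compress S A y = countB (λ z → BL S (proj S z) (proj S y)) (section S y) <ᵇ countB A (section S y)

  StronglyCompressed : (Vec ℕ d → Bool) → Set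
  StronglyCompressed A = ∀ S → NonemptyProper S → ∀ y → y ∈ vertsG → A y ≡ compress S A y

  start : Vec ℕ d → Vec ℕ d
  start c = tabulate (λ j → nth (ord j) (startPos j (lookup c j)))

  bone : Vec ℕ d → Fin d → ℕ → Vec ℕ d
  bone c i v = start c [ i ]≔ v

  -- Standing assumptions (d ≥ 3 is stated separately)
  StandingAssumptions : Set
  StandingAssumptions =
      (∀ j → OrderOptimal j)
    × (∀ j → IsoPartition j)
    × RegularDominationCollection
    × (∀ j → suc (toℕ j) < d → NonDecreasing j)
    × (∀ i j → toℕ i < toℕ j → OptimalBy adjP (vertsS (pairS i j)) (BL (pairS i j)))

  SubsetOfV : (Vec ℕ d → Bool) → Set
  SubsetOfV A = ∀ x → A x ≡ true → x ∈ vertsG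

  IsBlockOfG : Vec ℕ d → Set
  IsBlockOfG c = ValidBlock fullS c

  BlockLt : Vec ℕ d → Vec ℕ d → Set
  BlockLt c₁ c₂ = BL fullS (start c₁) (start c₂) ≡ true

  ShareBone : Vec ℕ d → Vec ℕ d → Fin d → Set
  ShareBone c₁ c₂ i = (c₁ ≢ c₂) × (lookup c₁ i ≡ lookup c₂ i)

  BoneIn : Vec ℕ d → Fin d → (Vec ℕ d → Bool) → Set
  BoneIn c i A = ∀ v → v ∈ part i (lookup c i) → A (bone c i v) ≡ true

  BlockIn : Vec ℕ d → (Vec ℕ d → Bool) → Set
  BlockIn c A = ∀ x → x ∈ blockVerts fullS c → A x ≡ true

-- Take x in B₁ and let S be the set of all coordinates except i.  The point
-- y of Bone(B₂, i) with the same i-th coordinate as x lies in A and in the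
-- same section G_S(x) as x.  Since B₁ and B₂ agree in coordinate i, the
-- lexicographic comparison of their starts is decided by coordinates in S,
-- so the blocks of G_S containing the projections of x and y are compared
-- the same way: x precedes y in BL_{G_S}.  A is compressed along S, so its
-- trace on G_S(x) is an initial segment of that order, and contains y,
-- hence x.

module Submission where

open import Defs
open import Data.Bool using (Bool; true; false; if_then_else_; _∧_; _∨_; not; T; T?)
open import Data.Bool.Properties using (T-≡; ¬-not)
open import Data.Empty using (⊥-elim)
open import Data.Fin using (Fin)
import Data.Fin as Fin
open import Data.List using (List; []; _∷_; length; take; drop; map; filterᵇ; allFin)
open import Data.List.Properties using (map-cong-local; filter-all; filter-≐; length-upTo)
open import Data.List.Membership.Propositional using (_∈_; find; lose)
open import Data.List.Membership.Propositional.Properties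
  using (∈-concatMap⁻; ∈-concatMap⁺; ∈-map⁻; ∈-map⁺; ∈-filter⁺)
open import Data.List.Relation.Binary.Permutation.Propositional using (_↭_; ↭-sym; ↭⇒↭ₛ)
open import Data.List.Relation.Binary.Permutation.Propositional.Properties using (∈-resp-↭; ↭-length)
open import Data.List.Relation.Binary.Permutation.Setoid.Properties using (Unique-resp-↭)
open import Data.List.Relation.Binary.Sublist.Propositional.Properties using (Any-resp-⊆; take-⊆; drop-⊆)
import Data.List.Relation.Unary.All as All
open import Data.List.Relation.Unary.All.Properties using (all-filter)
open import Data.List.Relation.Unary.Any using (here; there)
open import Data.List.Relation.Unary.Unique.Propositional using (Unique; _∷_)
open import Data.List.Relation.Unary.Unique.Propositional.Properties using (upTo⁺)
open import Data.Nat using (ℕ; zero; suc; _+_; _∸_; _≤_; _<_; _<ᵇ_; _≡ᵇ_; z≤n; s≤s)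
import Data.Nat as ℕ
open import Data.Nat.ListAction using (sum)
open import Data.Nat.Properties
open import Data.Product using (∃; _×_; _,_; proj₁; proj₂)
open import Data.Sum using (_⊎_; inj₁; inj₂)
open import Data.Vec using (Vec; lookup; tabulate)
import Data.Vec as Vec
open import Data.Vec.Properties using (≡-dec; lookup∘tabulate; lookup-replicate; tabulate∘lookup; tabulate-cong; lookup∘update; lookup∘update′)
open import Function using (_∘_; case_of_)
open import Function.Bundles using (Equivalence)
open import Relation.Nullary using (¬_; Dec; yes; no; does)
open import Relation.Binary.PropositionalEquality
  using (_≡_; _≢_; refl; sym; trans; cong; subst; subst₂; setoid; module ≡-Reasoning)

T⇒≡true : ∀ {b} → T b → b ≡ true
T⇒≡true = Equivalence.to T-≡

≡true⇒T : ∀ {b} → b ≡ true → T b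
≡true⇒T = Equivalence.from T-≡

<⇒<ᵇ≡true : ∀ {m n} → m < n → (m <ᵇ n) ≡ true
<⇒<ᵇ≡true = T⇒≡true ∘ <⇒<ᵇ

<ᵇ≡true⇒< : ∀ {m n} → (m <ᵇ n) ≡ true → m < n
<ᵇ≡true⇒< {m} {n} = <ᵇ⇒< m n ∘ ≡true⇒T

≡⇒≡ᵇ≡true : ∀ {m n} → m ≡ n → (m ≡ᵇ n) ≡ true
≡⇒≡ᵇ≡true {m} {n} = T⇒≡true ∘ ≡⇒≡ᵇ m n

≢⇒≡ᵇ≡false : ∀ {m n} → m ≢ n → (m ≡ᵇ n) ≡ false
≢⇒≡ᵇ≡false {m} {n} m≢n with m ≡ᵇ n in e
... | true = ⊥-elim (m≢n (≡ᵇ⇒≡ m n (≡true⇒T e)))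
... | false = refl

if-does-view : ∀ {P : Set} (dec : Dec P) {x y : Bool} → (if does dec then x else y) ≡ true →
  (P × x ≡ true) ⊎ (¬ P × y ≡ true)
if-does-view (yes p) h = inj₁ (p , h)
if-does-view (no ¬p) h = inj₂ (¬p , h)

if-does-yes : ∀ {P : Set} (dec : Dec P) {x y : Bool} → P → x ≡ true → (if does dec then x else y) ≡ true
if-does-yes (yes _) _ h = h
if-does-yes (no ¬p) p _ = ⊥-elim (¬p p)

if-does-no : ∀ {P : Set} (dec : Dec P) {x y : Bool} → ¬ P → y ≡ true → (if does dec then x else y) ≡ true
if-does-no (yes p) ¬p _ = ⊥-elim (¬p p)
if-does-no (no _) _ h = h

lookup-ext : ∀ {k} {u v : Vec ℕ k} → (∀ j → lookup u j ≡ lookup v j) → u ≡ v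
lookup-ext {u = u} {v} h = trans (sym (tabulate∘lookup u)) (trans (tabulate-cong h) (tabulate∘lookup v))

lexLtB-∷⁻ : ∀ {a b as bs} → lexLtB (a ∷ as) (b ∷ bs) ≡ true → a < b ⊎ (a ≡ b × lexLtB as bs ≡ true)
lexLtB-∷⁻ {a} {b} h with a <ᵇ b in a<b
... | true = inj₁ (<ᵇ≡true⇒< a<b)
... | false with a ≡ᵇ b in a≡b
...   | true = inj₂ (≡ᵇ⇒≡ a b (≡true⇒T a≡b) , h)

lexLtB-head : ∀ {a b} as bs → a < b → lexLtB (a ∷ as) (b ∷ bs) ≡ true
lexLtB-head _ _ a<b rewrite <⇒<ᵇ≡true a<b = refl

lexLtB-tail : ∀ a as bs → lexLtB as bs ≡ true → lexLtB (a ∷ as) (a ∷ bs) ≡ true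
lexLtB-tail a _ _ h with a <ᵇ a
... | true = refl
... | false rewrite ≡⇒≡ᵇ≡true {a} refl = h

lexLtB-irrefl : ∀ as → lexLtB as as ≢ true
lexLtB-irrefl (a ∷ as) h with lexLtB-∷⁻ {a} {a} {as} {as} h
... | inj₁ a<a = <-irrefl refl a<a
... | inj₂ (_ , t) = lexLtB-irrefl as t

lexLtB-trans : ∀ as bs cs → lexLtB as bs ≡ true → lexLtB bs cs ≡ true → lexLtB as cs ≡ true
lexLtB-trans (_ ∷ _) (_ ∷ _) [] _ ()
lexLtB-trans (a ∷ as) (b ∷ bs) (c ∷ cs) h₁ h₂ with lexLtB-∷⁻ {a} {b} {as} {bs} h₁ | lexLtB-∷⁻ {b} {c} {bs} {cs} h₂
... | inj₁ a<b        | inj₁ b<c        = lexLtB-head as cs (<-trans a<b b<c)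
... | inj₁ a<b        | inj₂ (refl , _) = lexLtB-head as cs a<b
... | inj₂ (refl , _) | inj₁ b<c        = lexLtB-head as cs b<c
... | inj₂ (refl , t) | inj₂ (refl , u) = lexLtB-tail a as cs (lexLtB-trans as bs cs t u)

lexLtB-filterᵇ : ∀ {X : Set} (P : X → Bool) (f g : X → ℕ) → (∀ x → P x ≡ false → f x ≡ g x) →
  ∀ L → lexLtB (map f L) (map g L) ≡ true → lexLtB (map f (filterᵇ P L)) (map g (filterᵇ P L)) ≡ true
lexLtB-filterᵇ P f g agree (x ∷ L) h with P x in Px | lexLtB-∷⁻ {f x} {g x} {map f L} {map g L} h
... | true  | inj₁ fx<gx        = lexLtB-head (map f (filterᵇ P L)) (map g (filterᵇ P L)) fx<gx
... | true  | inj₂ (fx≡gx , t) rewrite fx≡gx = lexLtB-tail (g x) (map f (filterᵇ P L)) (map g (filterᵇ P L))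
                                         (lexLtB-filterᵇ P f g agree L t)
... | false | inj₁ fx<gx        = ⊥-elim (<-irrefl (agree x Px) fx<gx)
... | false | inj₂ (_ , t)      = lexLtB-filterᵇ P f g agree L t

countB-mono : ∀ {X : Set} {p q : X → Bool} → (∀ z → p z ≡ true → q z ≡ true) →
  ∀ L → countB p L ≤ countB q L
countB-mono p⇒q [] = z≤n
countB-mono {p = p} {q} p⇒q (x ∷ L) with p x in px | q x in qx
... | true  | true  = s≤s (countB-mono p⇒q L)
... | true  | false with () ← trans (sym (p⇒q x px)) qx
... | false | true  = m≤n⇒m≤1+n (countB-mono p⇒q L)
... | false | false = countB-mono p⇒q L

countB-< : ∀ {X : Set} {p q : X → Bool} → (∀ z → p z ≡ true → q z ≡ true) →
  ∀ {w L} → w ∈ L → p w ≡ false → q w ≡ true → countB p L < countB q L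
countB-< p⇒q {L = _ ∷ L} (here refl) pw qw rewrite pw | qw = s≤s (countB-mono p⇒q L)
countB-< {p = p} {q} p⇒q {L = x ∷ L} (there w∈L) pw qw with p x in px | q x in qx
... | true  | true  = s≤s (countB-< p⇒q w∈L pw qw)
... | true  | false with () ← trans (sym (p⇒q x px)) qx
... | false | true  = m≤n⇒m≤1+n (countB-< p⇒q w∈L pw qw)
... | false | false = countB-< p⇒q w∈L pw qw

allB-true : ∀ {X : Set} {p : X → Bool} → (∀ x → p x ≡ true) → ∀ L → allB p L ≡ true
allB-true h [] = refl
allB-true h (x ∷ L) rewrite h x = allB-true h L

allB-cong : ∀ {X : Set} {p q : X → Bool} → (∀ x → p x ≡ q x) → ∀ L → allB p L ≡ allB q L
allB-cong h [] = refl
allB-cong {q = q} h (x ∷ L) rewrite h x = cong (q x ∧_) (allB-cong h L)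

filterᵇ-cong : ∀ {X : Set} {p q : X → Bool} → (∀ x → p x ≡ q x) → ∀ L → filterᵇ p L ≡ filterᵇ q L
filterᵇ-cong {p = p} {q} h = filter-≐ (T? ∘ p) (T? ∘ q) (subst T (h _) , subst T (sym (h _)))

∈-filterᵇ⁺ : ∀ {X : Set} {p : X → Bool} {x L} → x ∈ L → p x ≡ true → x ∈ filterᵇ p L
∈-filterᵇ⁺ {p = p} x∈L px = ∈-filter⁺ (T? ∘ p) x∈L (≡true⇒T px)

Unique-resp-↭′ : ∀ {xs ys : List ℕ} → xs ↭ ys → Unique xs → Unique ys
Unique-resp-↭′ p = Unique-resp-↭ (setoid ℕ) (↭⇒↭ₛ p)

∈-take⇒∈ : ∀ {v : ℕ} l xs → v ∈ take l xs → v ∈ xs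
∈-take⇒∈ l xs = Any-resp-⊆ (take-⊆ l xs)

∈-drop⇒∈ : ∀ {v : ℕ} s xs → v ∈ drop s xs → v ∈ xs
∈-drop⇒∈ s xs = Any-resp-⊆ (drop-⊆ s xs)

rankL-∈-take : ∀ {v} ord l → Unique ord → v ∈ take l ord → rankL ord v < l
rankL-∈-take {v} (w ∷ ws) (suc l) _ (here refl) rewrite ≡⇒≡ᵇ≡true {v} refl = s≤s z≤n
rankL-∈-take (w ∷ ws) (suc l) (w∉ws ∷ u) (there v∈) rewrite ≢⇒≡ᵇ≡false (All.lookup w∉ws (∈-take⇒∈ l ws v∈)) =
  s≤s (rankL-∈-take ws l u v∈)

rankL-∈-slice : ∀ {v} ord s l → Unique ord → v ∈ take l (drop s ord) → s ≤ rankL ord v × rankL ord v < s + l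
rankL-∈-slice ord zero l u v∈ = z≤n , rankL-∈-take ord l u v∈
rankL-∈-slice [] (suc s) zero _ ()
rankL-∈-slice [] (suc s) (suc l) _ ()
rankL-∈-slice (w ∷ ws) (suc s) l (w∉ws ∷ u) v∈
  rewrite ≢⇒≡ᵇ≡false (All.lookup w∉ws (∈-drop⇒∈ s ws (∈-take⇒∈ l _ v∈)))
  with rankL-∈-slice ws s l u v∈
... | s≤r , r<s+l = s≤s s≤r , s≤s r<s+l

partIdx-∈-interval : ∀ lens k p → sum (take k lens) ≤ p → p < sum (take k lens) + nth lens k → partIdx lens p ≡ k
partIdx-∈-interval (l ∷ ls) zero p _ p<l rewrite <⇒<ᵇ≡true p<l = refl
partIdx-∈-interval (l ∷ ls) (suc k) p l+s≤p p<l+s+n with p <ᵇ l in p<ᵇl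
... | true = ⊥-elim (<-irrefl refl (<-≤-trans (<ᵇ≡true⇒< p<ᵇl) (≤-trans (m≤m+n l _) l+s≤p)))
... | false = cong suc (partIdx-∈-interval ls k (p ∸ l) s≤p∸l p∸l<s+n)
  where
  s≤p∸l : sum (take k ls) ≤ p ∸ l
  s≤p∸l = subst (_≤ p ∸ l) (m+n∸m≡n l _) (∸-monoˡ-≤ l l+s≤p)
  p∸l<s+n : p ∸ l < sum (take k ls) + nth ls k
  p∸l<s+n = subst (p ∸ l <_) (m+n∸m≡n l _)
              (∸-monoˡ-< (subst (p <_) (+-assoc l _ _) p<l+s+n) (≤-trans (m≤m+n l _) l+s≤p))

nth-∈-slice : ∀ ord s l → s < length ord → 1 ≤ l → nth ord s ∈ take l (drop s ord)
nth-∈-slice (x ∷ ord) zero (suc l) _ _ = here refl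
nth-∈-slice (x ∷ ord) (suc s) l (s≤s s<len) 1≤l = nth-∈-slice ord s l s<len 1≤l

sum-take+nth≤sum : ∀ lens k → k < length lens → sum (take k lens) + nth lens k ≤ sum lens
sum-take+nth≤sum (l ∷ ls) zero _ = m≤m+n l _
sum-take+nth≤sum (l ∷ ls) (suc k) (s≤s k<len) =
  ≤-trans (≤-reflexive (+-assoc l _ _)) (+-monoʳ-≤ l (sum-take+nth≤sum ls k k<len))

nth-∈ : ∀ (xs : List ℕ) k → k < length xs → nth xs k ∈ xs
nth-∈ (x ∷ xs) zero _ = here refl
nth-∈ (x ∷ xs) (suc k) (s≤s k<len) = there (nth-∈ xs k k<len)

∈-prodL⁻ : ∀ {k} (rs : Vec (List ℕ) k) {x} → x ∈ prodL rs → ∀ j → lookup x j ∈ lookup rs j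
∈-prodL⁻ (r Vec.∷ rs) {a Vec.∷ x} x∈ j with find (∈-concatMap⁻ (λ b → map (b Vec.∷_) (prodL rs)) {xs = r} x∈)
... | b , b∈r , x∈b∷ with ∈-map⁻ (b Vec.∷_) x∈b∷
∈-prodL⁻ (r Vec.∷ rs) {a Vec.∷ x} x∈ Fin.zero    | b , b∈r , _ | _ , _ , refl = b∈r
∈-prodL⁻ (r Vec.∷ rs) {a Vec.∷ x} x∈ (Fin.suc j) | _ , _ , _ | _ , x∈rs , refl = ∈-prodL⁻ rs x∈rs j

∈-prodL⁺ : ∀ {k} (rs : Vec (List ℕ) k) {x} → (∀ j → lookup x j ∈ lookup rs j) → x ∈ prodL rs
∈-prodL⁺ Vec.[] {Vec.[]} _ = here refl
∈-prodL⁺ (r Vec.∷ rs) {a Vec.∷ x} h =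
  ∈-concatMap⁺ (λ b → map (b Vec.∷_) (prodL rs)) (lose (h Fin.zero) (∈-map⁺ (a Vec.∷_) (∈-prodL⁺ rs (h ∘ Fin.suc))))

∃-≢ : ∀ {d} → 2 ≤ d → (i : Fin d) → ∃ λ j → j ≢ i
∃-≢ {suc zero} (s≤s ()) Fin.zero
∃-≢ {suc (suc d)} _ Fin.zero    = Fin.suc Fin.zero , λ ()
∃-≢ {suc (suc d)} _ (Fin.suc i) = Fin.zero , λ ()

module ProductOrder {d : ℕ} (F : Factors d) (π : Vec Bool d → Vec ℕ d → List (Fin d)) where
  open Factors F
  open Product F π

  inS-fullS : ∀ j → inS fullS j ≡ true
  inS-fullS j = lookup-replicate j true

  lookup-if-inS : ∀ {X : Set} S (f g : Fin d → X) j → inS S j ≡ true →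
    lookup (tabulate (λ j → if inS S j then f j else g j)) j ≡ f j
  lookup-if-inS S f g j Sj rewrite lookup∘tabulate (λ j → if inS S j then f j else g j) j | Sj = refl

  lookup-proj : ∀ S x j → inS S j ≡ true → lookup (proj S x) j ≡ lookup x j
  lookup-proj S x = lookup-if-inS S (lookup x) (λ _ → 0)

  startTup-cong : ∀ S u v → blockOf S u ≡ blockOf S v → startTup S u ≡ startTup S v
  startTup-cong S _ _ = cong (λ B → map (λ j → startPos j (lookup B j)) (elems S))

  ranks : List (Fin d) → Vec ℕ d → List ℕ
  ranks p a = map (λ j → rank j (lookup a j)) p

  Dlt-trans : ∀ p a b c → Dlt p a b ≡ true → Dlt p b c ≡ true → Dlt p a c ≡ true
  Dlt-trans p a b c = lexLtB-trans (ranks p a) (ranks p b) (ranks p c)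

  BL-view : ∀ S a b → BL S a b ≡ true →
      (blockOf S a ≡ blockOf S b × Dlt (π S (blockOf S a)) a b ≡ true)
    ⊎ (blockOf S a ≢ blockOf S b × lexLtB (startTup S a) (startTup S b) ≡ true)
  BL-view S a b = if-does-view (≡-dec ℕ._≟_ (blockOf S a) (blockOf S b))

  BL-sameBlock : ∀ S a b → blockOf S a ≡ blockOf S b → Dlt (π S (blockOf S a)) a b ≡ true → BL S a b ≡ true
  BL-sameBlock S a b = if-does-yes (≡-dec ℕ._≟_ (blockOf S a) (blockOf S b))

  BL-otherBlock : ∀ S a b → blockOf S a ≢ blockOf S b → lexLtB (startTup S a) (startTup S b) ≡ true → BL S a b ≡ true
  BL-otherBlock S a b = if-does-no (≡-dec ℕ._≟_ (blockOf S a) (blockOf S b))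

  BL-irrefl : ∀ S a → BL S a a ≡ false
  BL-irrefl S a = ¬-not λ a<a → case BL-view S a a a<a of λ where
    (inj₁ (_ , lt)) → lexLtB-irrefl (ranks (π S (blockOf S a)) a) lt
    (inj₂ (ne , _)) → ne refl

  BL-trans : ∀ S a b c → BL S a b ≡ true → BL S b c ≡ true → BL S a c ≡ true
  BL-trans S a b c a<b b<c with BL-view S a b a<b | BL-view S b c b<c
  ... | inj₁ (ab , lt₁) | inj₁ (bc , lt₂) =
    BL-sameBlock S a c (trans ab bc) (Dlt-trans (π S (blockOf S a)) a b c lt₁ (subst (λ B → Dlt (π S B) b c ≡ true) (sym ab) lt₂))
  ... | inj₁ (ab , _) | inj₂ (b≁c , lt₂) =
    BL-otherBlock S a c (λ ac → b≁c (trans (sym ab) ac)) (subst (λ s → lexLtB s (startTup S c) ≡ true) (startTup-cong S b a (sym ab)) lt₂)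
  ... | inj₂ (a≁b , lt₁) | inj₁ (bc , _) =
    BL-otherBlock S a c (λ ac → a≁b (trans ac (sym bc))) (subst (λ t → lexLtB (startTup S a) t ≡ true) (startTup-cong S b c bc) lt₁)
  ... | inj₂ (_ , lt₁) | inj₂ (_ , lt₂) = case ≡-dec ℕ._≟_ (blockOf S a) (blockOf S c) of λ where
    (yes ac) → ⊥-elim (lexLtB-irrefl (startTup S a) (lexLtB-trans (startTup S a) (startTup S b) (startTup S a) lt₁
                 (subst (λ t → lexLtB (startTup S b) t ≡ true) (sym (startTup-cong S a c ac)) lt₂)))
    (no a≁c) → BL-otherBlock S a c a≁c (lexLtB-trans (startTup S a) (startTup S b) (startTup S c) lt₁ lt₂)

  AgreeOutside : Vec Bool d → Vec ℕ d → Vec ℕ d → Set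
  AgreeOutside S x y = ∀ j → inS S j ≡ false → lookup x j ≡ lookup y j

  section-cong : ∀ S x y → AgreeOutside S x y → section S x ≡ section S y
  section-cong S x y x~y = filterᵇ-cong (λ z → allB-cong (same-test z) (allFin d)) vertsG
    where
    same-test : ∀ z j → (inS S j ∨ (lookup z j ≡ᵇ lookup x j)) ≡ (inS S j ∨ (lookup z j ≡ᵇ lookup y j))
    same-test z j with inS S j in Sj
    ... | true  = refl
    ... | false = cong (lookup z j ≡ᵇ_) (x~y j Sj)

  ∈-section : ∀ S x y → x ∈ vertsG → AgreeOutside S x y → x ∈ section S y
  ∈-section S x y x∈ x~y = ∈-filterᵇ⁺ x∈ (allB-true passes-test (allFin d))
    where
    passes-test : ∀ j → (inS S j ∨ (lookup x j ≡ᵇ lookup y j)) ≡ true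
    passes-test j with inS S j in Sj
    ... | true  = refl
    ... | false = ≡⇒≡ᵇ≡true (x~y j Sj)

  -- x lies in the compression iff fewer points of its section precede x than
  -- A has there, and the predecessors of y include those of x and x itself.
  stronglyCompressed-downward : ∀ {A} → StronglyCompressed A → ∀ {S} → NonemptyProper S →
    ∀ {x y} → x ∈ vertsG → y ∈ vertsG → AgreeOutside S x y →
    BL S (proj S x) (proj S y) ≡ true → A y ≡ true → A x ≡ true
  stronglyCompressed-downward {A} compressed {S} np {x} {y} x∈ y∈ x~y x<y Ay =
    begin
      A x                                                         ≡⟨ compressed S np x x∈ ⟩
      compress S A x                                              ≡⟨ cong (λ L → countB (below x) L <ᵇ countB A L) (section-cong S x y x~y) ⟩
      countB (below x) (section S y) <ᵇ countB A (section S y)   ≡⟨ <⇒<ᵇ≡true (<-trans below-x<below-y below-y<A) ⟩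
      true                                                        ∎
    where
    open ≡-Reasoning
    below : Vec ℕ d → Vec ℕ d → Bool
    below w z = BL S (proj S z) (proj S w)
    below-x<below-y : countB (below x) (section S y) < countB (below y) (section S y)
    below-x<below-y = countB-< (λ z z<x → BL-trans S (proj S z) (proj S x) (proj S y) z<x x<y) (∈-section S x y x∈ x~y) (BL-irrefl S (proj S x)) x<y
    below-y<A : countB (below y) (section S y) < countB A (section S y)
    below-y<A = <ᵇ≡true⇒< (trans (sym (compressed S np y y∈)) Ay)

  allBut : Fin d → Vec Bool d
  allBut i = tabulate (λ j → not (does (j Fin.≟ i)))

  allBut-≢ : ∀ {i j} → j ≢ i → inS (allBut i) j ≡ true
  allBut-≢ {i} {j} j≢i rewrite lookup∘tabulate (λ j → not (does (j Fin.≟ i))) j with j Fin.≟ i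
  ... | yes j≡i = ⊥-elim (j≢i j≡i)
  ... | no _    = refl

  allBut-self : ∀ i → inS (allBut i) i ≡ false
  allBut-self i rewrite lookup∘tabulate (λ j → not (does (j Fin.≟ i))) i with i Fin.≟ i
  ... | yes _  = refl
  ... | no i≢i = ⊥-elim (i≢i refl)

  allBut-false : ∀ {i j} → inS (allBut i) j ≡ false → j ≡ i
  allBut-false {i} {j} Sj with j Fin.≟ i
  ... | yes j≡i = j≡i
  ... | no j≢i with () ← trans (sym (allBut-≢ j≢i)) Sj

  allBut-nonemptyProper : 2 ≤ d → ∀ i → NonemptyProper (allBut i)
  allBut-nonemptyProper 2≤d i with j , j≢i ← ∃-≢ 2≤d i = (j , allBut-≢ j≢i) , (i , allBut-self i)

  record InBlock (c x : Vec ℕ d) : Set where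
    constructor inBlock
    field lookup-∈-part : ∀ j → lookup x j ∈ part j (lookup c j)
  open InBlock

  record BlockOn (S : Vec Bool d) (z c : Vec ℕ d) : Set where
    constructor blockOn
    field lookup-blockOf : ∀ j → inS S j ≡ true → lookup (blockOf S z) j ≡ lookup c j
  open BlockOn

  startRank : Vec ℕ d → Fin d → ℕ
  startRank c j = startPos j (lookup c j)

  startTup-BlockOn : ∀ S {z c} → BlockOn S z c → startTup S z ≡ map (startRank c) (elems S)
  startTup-BlockOn S on = map-cong-local
    (All.map (λ {j} Sj → cong (startPos j) (lookup-blockOf on j (T⇒≡true Sj))) (all-filter (T? ∘ inS S) (allFin d)))

  elems-fullS : elems fullS ≡ allFin d
  elems-fullS = filter-all (T? ∘ inS fullS) (All.tabulate (λ {j} _ → ≡true⇒T (inS-fullS j)))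

  AgreeOutside-fullS : ∀ c c' → AgreeOutside fullS c c'
  AgreeOutside-fullS c c' j fullSj with () ← trans (sym (inS-fullS j)) fullSj

  blockOf-≡⇒≡ : ∀ {S z w c c'} → BlockOn S z c → BlockOn S w c' → AgreeOutside S c c' →
    blockOf S z ≡ blockOf S w → c ≡ c'
  blockOf-≡⇒≡ {S} {c = c} {c'} z-on w-on c~c' zw = lookup-ext same
    where
    same : ∀ j → lookup c j ≡ lookup c' j
    same j with inS S j in Sj
    ... | true  = trans (sym (lookup-blockOf z-on j Sj)) (trans (cong (λ B → lookup B j) zw) (lookup-blockOf w-on j Sj))
    ... | false = c~c' j Sj

  module Blocks (ord↭V : ∀ j → ord j ↭ V j) (partition : ∀ j → IsoPartition j) where

    ord-unique : ∀ j → Unique (ord j)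
    ord-unique j = Unique-resp-↭′ (↭-sym (ord↭V j)) (upTo⁺ (n j))

    part-⊆-V : ∀ {j k v} → v ∈ part j k → v ∈ V j
    part-⊆-V {j} {k} v∈ = ∈-resp-↭ (ord↭V j) (∈-drop⇒∈ (startPos j k) (ord j) (∈-take⇒∈ (nth (lens j) k) _ v∈))

    start-∈-part : ∀ j k → k < numParts j → nth (ord j) (startPos j k) ∈ part j k
    start-∈-part j k k<parts = nth-∈-slice (ord j) (startPos j k) (nth (lens j) k) start<length 1≤length
      where
      1≤length : 1 ≤ nth (lens j) k
      1≤length = proj₁ (partition j) _ (nth-∈ (lens j) k k<parts)
      length-ord : length (ord j) ≡ n j
      length-ord = trans (↭-length (ord↭V j)) (length-upTo (n j))
      start<length : startPos j k < length (ord j)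
      start<length = begin-strict
        startPos j k                      <⟨ m<m+n (startPos j k) 1≤length ⟩
        startPos j k + nth (lens j) k     ≤⟨ sum-take+nth≤sum (lens j) k k<parts ⟩
        sum (lens j)                      ≡⟨ trans (proj₁ (proj₂ (partition j))) (sym length-ord) ⟩
        length (ord j)                    ∎
        where open ≤-Reasoning

    blockOf-lookup : ∀ S z c j → inS S j ≡ true → lookup z j ∈ part j (lookup c j) →
      lookup (blockOf S z) j ≡ lookup c j
    blockOf-lookup S z c j Sj z∈ with rankL-∈-slice (ord j) _ _ (ord-unique j) z∈
    ... | lower , upper = trans (lookup-if-inS S _ _ j Sj) (partIdx-∈-interval (lens j) (lookup c j) _ lower upper)

    BlockOn-fullS : ∀ {c z} → InBlock c z → BlockOn fullS z c
    BlockOn-fullS {c} {z} z∈ = blockOn λ j _ → blockOf-lookup fullS z c j (inS-fullS j) (lookup-∈-part z∈ j)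

    BlockOn-proj : ∀ S {c x} → InBlock c x → BlockOn S (proj S x) c
    BlockOn-proj S {c} {x} x∈ = blockOn λ j Sj →
      blockOf-lookup S (proj S x) c j Sj (subst (_∈ part j (lookup c j)) (sym (lookup-proj S x j Sj)) (lookup-∈-part x∈ j))

    ∈-blockVerts⁻ : ∀ {c x} → x ∈ blockVerts fullS c → InBlock c x
    ∈-blockVerts⁻ {c} {x} x∈ = inBlock λ j → subst (lookup x j ∈_)
      (lookup-if-inS fullS (λ j → part j (lookup c j)) (λ _ → 0 ∷ []) j (inS-fullS j))
      (∈-prodL⁻ (tabulate (λ j → if inS fullS j then part j (lookup c j) else 0 ∷ [])) x∈ j)

    InBlock⇒∈vertsG : ∀ {c x} → InBlock c x → x ∈ vertsG
    InBlock⇒∈vertsG {c} {x} x∈ = ∈-prodL⁺ (tabulate (λ j → if inS fullS j then V j else 0 ∷ []))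
      (λ j → subst (lookup x j ∈_) (sym (lookup-if-inS fullS V (λ _ → 0 ∷ []) j (inS-fullS j))) (part-⊆-V (lookup-∈-part x∈ j)))

    InBlock-start : ∀ {c} → IsBlockOfG c → InBlock c (start c)
    InBlock-start {c} B = inBlock λ j →
      subst (_∈ part j (lookup c j)) (sym (lookup∘tabulate (λ j → nth (ord j) (startPos j (lookup c j))) j))
        (start-∈-part j (lookup c j) (proj₁ (B j) (inS-fullS j)))

    InBlock-bone : ∀ {c i v} → IsBlockOfG c → v ∈ part i (lookup c i) → InBlock c (bone c i v)
    InBlock-bone {c} {i} {v} B v∈ = inBlock bone-∈-part
      where
      bone-∈-part : ∀ j → lookup (bone c i v) j ∈ part j (lookup c j)
      bone-∈-part j with j Fin.≟ i
      ... | yes refl = subst (_∈ part i (lookup c i)) (sym (lookup∘update i (start c) v)) v∈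
      ... | no j≢i   = subst (_∈ part j (lookup c j)) (sym (lookup∘update′ j≢i (start c) v))
                         (lookup-∈-part (InBlock-start {c} B) j)

    BlockLt⇒BL-proj : ∀ S {c₁ c₂ x y} → IsBlockOfG c₁ → IsBlockOfG c₂ → BlockLt c₁ c₂ → c₁ ≢ c₂ →
      AgreeOutside S c₁ c₂ → InBlock c₁ x → InBlock c₂ y → BL S (proj S x) (proj S y) ≡ true
    BlockLt⇒BL-proj S {c₁} {c₂} {x} {y} B₁ B₂ B₁<B₂ c₁≢c₂ c₁~c₂ x∈ y∈ =
      BL-otherBlock S (proj S x) (proj S y) other-blocks starts-in-S
      where
      starts-of : ∀ {c} → IsBlockOfG c → startTup fullS (start c) ≡ map (startRank c) (allFin d)
      starts-of {c} B = trans (startTup-BlockOn fullS (BlockOn-fullS (InBlock-start {c} B))) (cong (map (startRank c)) elems-fullS)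
      starts : lexLtB (map (startRank c₁) (allFin d)) (map (startRank c₂) (allFin d)) ≡ true
      starts with BL-view fullS (start c₁) (start c₂) B₁<B₂
      ... | inj₁ (same , _) = ⊥-elim (c₁≢c₂ (blockOf-≡⇒≡ (BlockOn-fullS (InBlock-start {c₁} B₁))
                                (BlockOn-fullS (InBlock-start {c₂} B₂)) (AgreeOutside-fullS c₁ c₂) same))
      ... | inj₂ (_ , lt)   = subst₂ (λ s t → lexLtB s t ≡ true) (starts-of {c₁} B₁) (starts-of {c₂} B₂) lt
      starts-in-S : lexLtB (startTup S (proj S x)) (startTup S (proj S y)) ≡ true
      starts-in-S = subst₂ (λ s t → lexLtB s t ≡ true)
        (sym (startTup-BlockOn S (BlockOn-proj S x∈))) (sym (startTup-BlockOn S (BlockOn-proj S y∈)))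
        (lexLtB-filterᵇ (inS S) (startRank c₁) (startRank c₂) (λ j Sj → cong (startPos j) (c₁~c₂ j Sj)) (allFin d) starts)
      other-blocks : blockOf S (proj S x) ≢ blockOf S (proj S y)
      other-blocks = c₁≢c₂ ∘ blockOf-≡⇒≡ (BlockOn-proj S x∈) (BlockOn-proj S y∈) c₁~c₂

lemma9 : (d : ℕ) → 3 ≤ d → (F : Factors d) → (π : Vec Bool d → Vec ℕ d → List (Fin d)) →
    Product.StandingAssumptions F π →
    (A : Vec ℕ d → Bool) → Product.SubsetOfV F π A → Product.StronglyCompressed F π A →
    (c₁ c₂ : Vec ℕ d) → Product.IsBlockOfG F π c₁ → Product.IsBlockOfG F π c₂ →
    Product.BlockLt F π c₁ c₂ →
    (i : Fin d) → Product.ShareBone F π c₁ c₂ i →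
    Product.BoneIn F π c₂ i A →
    Product.BlockIn F π c₁ A
lemma9 d 3≤d F π assumptions A _ compressed c₁ c₂ B₁ B₂ B₁<B₂ i (c₁≢c₂ , shared) bone⊆A x x∈B₁ =
  stronglyCompressed-downward compressed (allBut-nonemptyProper (≤-trans (n≤1+n 2) 3≤d) i)
    (InBlock⇒∈vertsG x∈) (InBlock⇒∈vertsG y∈) x~y
    (BlockLt⇒BL-proj S {c₁} {c₂} B₁ B₂ B₁<B₂ c₁≢c₂ c₁~c₂ x∈ y∈)
    (bone⊆A (lookup x i) xᵢ∈)
  where
  open Factors F
  open Product F π
  open ProductOrder F π
  open Blocks (λ j → proj₁ (proj₁ assumptions j)) (proj₁ (proj₂ assumptions))
  S = allBut i
  y = bone c₂ i (lookup x i)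
  x∈ : InBlock c₁ x
  x∈ = ∈-blockVerts⁻ x∈B₁
  xᵢ∈ : lookup x i ∈ part i (lookup c₂ i)
  xᵢ∈ = subst (λ k → lookup x i ∈ part i k) shared (InBlock.lookup-∈-part x∈ i)
  y∈ : InBlock c₂ y
  y∈ = InBlock-bone {c₂} B₂ xᵢ∈
  x~y : AgreeOutside S x y
  x~y j Sj rewrite allBut-false Sj = sym (lookup∘update i (start c₂) (lookup x i))
  c₁~c₂ : AgreeOutside S c₁ c₂
  c₁~c₂ j Sj rewrite allBut-false Sj = shared
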